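{- Let $n\ge2$ and let $k$ be an integer with $2n-2\le k\le\frac12(n^2-n+2)$. Then there is a set $S\subset\mathbb{R}$ of $n$ distinct points such that the number of distinct orderings of $S$ without ties produced by two vantage points $V_1,V_2\in\mathbb{R}$ is exactly $k$.
   Context: For vantage points $V_1,V_2\in\mathbb{R}$, the ordering of $S$ puts $P$ before $Q$ iff $|V_1-P|+|V_2-P|<|V_1-Q|+|V_2-Q|$; only pairs $(V_1,V_2)$ for which these sums are pairwise distinct over $S$ are used, and the orderings so obtained are counted.
   Formalization: The points of S and the vantage points $V_1,V_2$ are taken in ℚ instead of ℝ. -}

module Defs where

open import Data.Nat using (ℕ)
open import Data.Fin using (Fin)
open import Data.Rational using (ℚ; ∣_∣; _+_; _-_; _<_)
open import Data.Product using (Σ; _×_; _,_)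
open import Function.Bundles using (_⇔_)
open import Relation.Binary.PropositionalEquality using (_≡_; _≢_)

-- A point set S ⊂ ℝ of n points is given as an indexing S : Fin n → ℚ.

distSum : ℚ → ℚ → ℚ → ℚ
distSum V₁ V₂ P = ∣ V₁ - P ∣ + ∣ V₂ - P ∣

Distinct : {n : ℕ} → (Fin n → ℚ) → Set
Distinct {n} S = (i j : Fin n) → S i ≡ S j → i ≡ j

TieFree : {n : ℕ} → (Fin n → ℚ) → ℚ × ℚ → Set
TieFree {n} S (V₁ , V₂) =
  (i j : Fin n) → i ≢ j → distSum V₁ V₂ (S i) ≢ distSum V₁ V₂ (S j)

SameOrdering : {n : ℕ} → (Fin n → ℚ) → ℚ × ℚ → ℚ × ℚ → Set
SameOrdering {n} S (V₁ , V₂) (W₁ , W₂) =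
  (i j : Fin n) →
    (distSum V₁ V₂ (S i) < distSum V₁ V₂ (S j))
      ⇔ (distSum W₁ W₂ (S i) < distSum W₁ W₂ (S j))

NumOrderings : {n : ℕ} → (Fin n → ℚ) → ℕ → Set
NumOrderings {n} S k =
  Σ (Fin k → ℚ × ℚ) λ W →
    ((a : Fin k) → TieFree S (W a))
    × ((a b : Fin k) → SameOrdering S (W a) (W b) → a ≡ b)
    × ((V : ℚ × ℚ) → TieFree S V → Σ (Fin k) λ a → SameOrdering S V (W a))

-- For a < b, a tie-free vantage pair (V₁, V₂) puts a before b exactly when V₁ + V₂ < a + b:
-- the distance sum is non-decreasing away from the midpoint (V₁ + V₂)/2 on either side.
-- So a tie-free ordering only depends on where V₁ + V₂ lies among the pairwise sums a + b,
-- and a point set with m distinct pairwise sums has exactly m + 1 orderings (one vantage pair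
-- just below each pairwise sum, one above all of them).  It remains to realise every
-- 2n − 3 ≤ m ≤ C(n, 2) as the number of pairwise sums of n integers: {0, …, n − 2} ∪ {y}
-- gives every m up to 3n − 6, and adding a point larger than all pairwise sums adds n − 1 new
-- sums, which covers the rest by induction on n.

module Submission where

open import Defs

module Vantage where

  open import Data.Rational
  open import Data.Rational.Properties
  open import Data.Empty using (⊥-elim)
  open import Data.Fin using (Fin)
  open import Data.List using (_∷_; [])
  open import Data.Product using (_×_; _,_)
  open import Data.Sum using (inj₁; inj₂)
  open import Function.Bundles using (_⇔_; mk⇔)
  import Function.Properties.Equivalence as ⇔
  open import Function.Related.TypeIsomorphisms using (¬-cong-⇔)
  open import Level using (0ℓ)
  open import Relation.Binary.Definitions using (tri<; tri≈; tri>)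
  open import Relation.Binary.PropositionalEquality
  open import Relation.Nullary using (¬_; yes; no)
  open import Relation.Nullary.Decidable.Core using (dec⇒maybe)
  open import Tactic.RingSolver using (solve)
  open import Tactic.RingSolver.Core.AlmostCommutativeRing using (AlmostCommutativeRing; fromCommutativeRing)

  ℚ-ring : AlmostCommutativeRing 0ℓ 0ℓ
  ℚ-ring = fromCommutativeRing +-*-commutativeRing (λ p → dec⇒maybe (0ℚ ≟ p))

  private variable p q r d P Q V₁ V₂ v : ℚ

  gap⇒≤ : 0ℚ ≤ d → p + d ≡ q → p ≤ q
  gap⇒≤ {d} {p} 0≤d refl = begin
    p      ≡⟨ +-identityʳ p ⟨
    p + 0ℚ ≤⟨ +-monoʳ-≤ p 0≤d ⟩
    p + d  ∎
    where open ≤-Reasoning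

  gap⇒< : 0ℚ < d → p + d ≡ q → p < q
  gap⇒< {d} {p} 0<d refl = begin-strict
    p      ≡⟨ +-identityʳ p ⟨
    p + 0ℚ <⟨ +-monoʳ-< p 0<d ⟩
    p + d  ∎
    where open ≤-Reasoning

  p≤q⇒0≤q-p : p ≤ q → 0ℚ ≤ q - p
  p≤q⇒0≤q-p {p} {q} p≤q = subst (_≤ q - p) (+-inverseʳ p) (+-monoˡ-≤ (- p) p≤q)

  p<q⇒0<q-p : p < q → 0ℚ < q - p
  p<q⇒0<q-p {p} {q} p<q = subst (_< q - p) (+-inverseʳ p) (+-monoˡ-< (- p) p<q)

  ≤∧≢⇒< : p ≤ q → p ≢ q → p < q
  ≤∧≢⇒< {p} {q} p≤q p≢q with p <? q
  ... | yes p<q = p<q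
  ... | no  p≮q = ⊥-elim (p≢q (≤-antisym p≤q (≮⇒≥ p≮q)))

  <⇔≯ : p ≢ q → (p < q ⇔ (¬ q < p))
  <⇔≯ p≢q = mk⇔ <-asym (λ q≮p → ≤∧≢⇒< (≮⇒≥ q≮p) p≢q)

  p≤∣p∣ : ∀ p → p ≤ ∣ p ∣
  p≤∣p∣ p with ∣p∣≡p∨∣p∣≡-p p
  ... | inj₁ ∣p∣≡p  = ≤-reflexive (sym ∣p∣≡p)
  ... | inj₂ ∣p∣≡-p = gap⇒≤ (+-mono-≤ 0≤-p 0≤-p) (trans p-2p≡-p (sym ∣p∣≡-p))
    where
    p-2p≡-p : p + (- p + - p) ≡ - p
    p-2p≡-p = solve (p ∷ []) ℚ-ring
    0≤-p : 0ℚ ≤ - p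
    0≤-p = subst (0ℚ ≤_) ∣p∣≡-p (0≤∣p∣ p)

  -p≤∣p∣ : ∀ p → - p ≤ ∣ p ∣
  -p≤∣p∣ p = subst (- p ≤_) (∣-p∣≡∣p∣ p) (p≤∣p∣ (- p))

  p<q∧-p<q⇒∣p∣<q : p < q → - p < q → ∣ p ∣ < q
  p<q∧-p<q⇒∣p∣<q {p} p<q -p<q with ∣p∣≡p∨∣p∣≡-p p
  ... | inj₁ ∣p∣≡p  = subst (_< _) (sym ∣p∣≡p) p<q
  ... | inj₂ ∣p∣≡-p = subst (_< _) (sym ∣p∣≡-p) -p<q

  ±p±q≤r⇒∣p∣+∣q∣≤r : p + q ≤ r → p - q ≤ r → - p + q ≤ r → - p - q ≤ r → ∣ p ∣ + ∣ q ∣ ≤ r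
  ±p±q≤r⇒∣p∣+∣q∣≤r {p} {q} h₁ h₂ h₃ h₄ with ∣p∣≡p∨∣p∣≡-p p | ∣p∣≡p∨∣p∣≡-p q
  ... | inj₁ eq₁ | inj₁ eq₂ rewrite eq₁ | eq₂ = h₁
  ... | inj₁ eq₁ | inj₂ eq₂ rewrite eq₁ | eq₂ = h₂
  ... | inj₂ eq₁ | inj₁ eq₂ rewrite eq₁ | eq₂ = h₃
  ... | inj₂ eq₁ | inj₂ eq₂ rewrite eq₁ | eq₂ = h₄

  distSum-mono-≤ : ∀ V₁ V₂ → P ≤ Q → V₁ + V₂ ≤ P + Q → distSum V₁ V₂ P ≤ distSum V₁ V₂ Q
  distSum-mono-≤ {P} {Q} V₁ V₂ P≤Q s≤P+Q = ±p±q≤r⇒∣p∣+∣q∣≤r {V₁ - P} {V₂ - P}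
    (≤-trans (gap⇒≤ (+-mono-≤ 0≤t 0≤t) eq₁) (+-mono-≤ (-p≤∣p∣ a) (-p≤∣p∣ b)))
    (≤-trans (≤-reflexive eq₂) (+-mono-≤ (p≤∣p∣ a) (-p≤∣p∣ b)))
    (≤-trans (≤-reflexive eq₃) (+-mono-≤ (-p≤∣p∣ a) (p≤∣p∣ b)))
    (≤-trans (gap⇒≤ (+-mono-≤ 0≤δ 0≤δ) eq₄) (+-mono-≤ (-p≤∣p∣ a) (-p≤∣p∣ b)))
    where
    a = V₁ - Q
    b = V₂ - Q
    0≤t : 0ℚ ≤ (P + Q) - (V₁ + V₂)
    0≤t = p≤q⇒0≤q-p s≤P+Q
    0≤δ : 0ℚ ≤ Q - P
    0≤δ = p≤q⇒0≤q-p P≤Q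
    eq₁ : (V₁ - P) + (V₂ - P) + (((P + Q) - (V₁ + V₂)) + ((P + Q) - (V₁ + V₂))) ≡ - (V₁ - Q) - (V₂ - Q)
    eq₁ = solve (V₁ ∷ V₂ ∷ P ∷ Q ∷ []) ℚ-ring
    eq₂ : (V₁ - P) - (V₂ - P) ≡ (V₁ - Q) - (V₂ - Q)
    eq₂ = solve (V₁ ∷ V₂ ∷ P ∷ Q ∷ []) ℚ-ring
    eq₃ : - (V₁ - P) + (V₂ - P) ≡ - (V₁ - Q) + (V₂ - Q)
    eq₃ = solve (V₁ ∷ V₂ ∷ P ∷ Q ∷ []) ℚ-ring
    eq₄ : - (V₁ - P) - (V₂ - P) + ((Q - P) + (Q - P)) ≡ - (V₁ - Q) - (V₂ - Q)
    eq₄ = solve (V₁ ∷ V₂ ∷ P ∷ Q ∷ []) ℚ-ring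

  neg-sum-antimono-≤ : p + q ≤ r + d → - r + - d ≤ - q + - p
  neg-sum-antimono-≤ {p} {q} {r} {d} h =
    subst₂ _≤_ (neg-distrib-+ r d) (trans (neg-distrib-+ p q) (+-comm (- p) (- q))) (neg-antimono-≤ h)

  neg-sum-antimono-< : p + q < r + d → - r + - d < - q + - p
  neg-sum-antimono-< {p} {q} {r} {d} h =
    subst₂ _<_ (neg-distrib-+ r d) (trans (neg-distrib-+ p q) (+-comm (- p) (- q))) (neg-antimono-< h)

  distSum-neg : ∀ V₁ V₂ P → distSum (- V₁) (- V₂) (- P) ≡ distSum V₁ V₂ P
  distSum-neg V₁ V₂ P = cong₂ _+_ (∣-V+P∣ V₁) (∣-V+P∣ V₂)
    where
    ∣-V+P∣ : ∀ V → ∣ - V - - P ∣ ≡ ∣ V - P ∣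
    ∣-V+P∣ V = trans (cong ∣_∣ -V+P≡-[V-P]) (∣-p∣≡∣p∣ (V - P))
      where
      -V+P≡-[V-P] : - V - - P ≡ - (V - P)
      -V+P≡-[V-P] = solve (V ∷ P ∷ []) ℚ-ring

  distSum-anti-≤ : ∀ V₁ V₂ → P ≤ Q → P + Q ≤ V₁ + V₂ → distSum V₁ V₂ Q ≤ distSum V₁ V₂ P
  distSum-anti-≤ {P} {Q} V₁ V₂ P≤Q P+Q≤s = subst₂ _≤_ (distSum-neg V₁ V₂ Q) (distSum-neg V₁ V₂ P)
    (distSum-mono-≤ (- V₁) (- V₂) (neg-antimono-≤ P≤Q) (neg-sum-antimono-≤ {P} {Q} {V₁} {V₂} P+Q≤s))

  distSum-diagonal-< : ∀ v → P < Q → v + v < P + Q → distSum v v P < distSum v v Q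
  distSum-diagonal-< {P} {Q} v P<Q 2v<P+Q = +-mono-< ∣v-P∣<∣v-Q∣ ∣v-P∣<∣v-Q∣
    where
    eq₁ : (v - P) + ((P + Q) - (v + v)) ≡ - (v - Q)
    eq₁ = solve (v ∷ P ∷ Q ∷ []) ℚ-ring
    eq₂ : - (v - P) + (Q - P) ≡ - (v - Q)
    eq₂ = solve (v ∷ P ∷ Q ∷ []) ℚ-ring
    ∣v-P∣<∣v-Q∣ : ∣ v - P ∣ < ∣ v - Q ∣
    ∣v-P∣<∣v-Q∣ = <-≤-trans
      (p<q∧-p<q⇒∣p∣<q (gap⇒< (p<q⇒0<q-p 2v<P+Q) eq₁) (gap⇒< (p<q⇒0<q-p P<Q) eq₂))
      (-p≤∣p∣ (v - Q))

  distSum-diagonal-> : ∀ v → P < Q → P + Q < v + v → distSum v v Q < distSum v v P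
  distSum-diagonal-> {P} {Q} v P<Q P+Q<2v = subst₂ _<_ (distSum-neg v v Q) (distSum-neg v v P)
    (distSum-diagonal-< (- v) (neg-antimono-< P<Q) (neg-sum-antimono-< {P} {Q} {v} {v} P+Q<2v))

  distSum-diagonal-≢-of-< : ∀ v → P < Q → v + v ≢ P + Q → distSum v v P ≢ distSum v v Q
  distSum-diagonal-≢-of-< {P} {Q} v P<Q 2v≢P+Q with <-cmp (v + v) (P + Q)
  ... | tri< 2v<P+Q _ _ = <⇒≢ (distSum-diagonal-< v P<Q 2v<P+Q)
  ... | tri≈ _ 2v≡P+Q _ = ⊥-elim (2v≢P+Q 2v≡P+Q)
  ... | tri> _ _ P+Q<2v = ≢-sym (<⇒≢ (distSum-diagonal-> v P<Q P+Q<2v))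

  distSum-diagonal-≢ : ∀ v → P ≢ Q → v + v ≢ P + Q → distSum v v P ≢ distSum v v Q
  distSum-diagonal-≢ {P} {Q} v P≢Q 2v≢P+Q with <-cmp P Q
  ... | tri< P<Q _ _ = distSum-diagonal-≢-of-< v P<Q 2v≢P+Q
  ... | tri≈ _ P≡Q _ = ⊥-elim (P≢Q P≡Q)
  ... | tri> _ _ Q<P = ≢-sym (distSum-diagonal-≢-of-< v Q<P (subst (v + v ≢_) (+-comm P Q) 2v≢P+Q))

  distSum-<⇔ : ∀ V₁ V₂ → P < Q → distSum V₁ V₂ P ≢ distSum V₁ V₂ Q →
    (distSum V₁ V₂ P < distSum V₁ V₂ Q ⇔ V₁ + V₂ < P + Q)
  distSum-<⇔ {P} {Q} V₁ V₂ P<Q tie-free = mk⇔ to from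
    where
    to : distSum V₁ V₂ P < distSum V₁ V₂ Q → V₁ + V₂ < P + Q
    to dP<dQ with V₁ + V₂ <? P + Q
    ... | yes s<P+Q = s<P+Q
    ... | no  s≮P+Q = ⊥-elim (<-irrefl refl (<-≤-trans dP<dQ (distSum-anti-≤ V₁ V₂ (<⇒≤ P<Q) (≮⇒≥ s≮P+Q))))
    from : V₁ + V₂ < P + Q → distSum V₁ V₂ P < distSum V₁ V₂ Q
    from s<P+Q = ≤∧≢⇒< (distSum-mono-≤ V₁ V₂ (<⇒≤ P<Q) (<⇒≤ s<P+Q)) tie-free

  SameSide : ∀ {n} → (Fin n → ℚ) → ℚ × ℚ → ℚ × ℚ → Set
  SameSide {n} S (V₁ , V₂) (W₁ , W₂) =
    (i j : Fin n) → S i < S j → (V₁ + V₂ < S i + S j ⇔ W₁ + W₂ < S i + S j)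

  sameOrdering⇔sameSide : ∀ {n} {S : Fin n → ℚ} V W → TieFree S V → TieFree S W →
    SameOrdering S V W ⇔ SameSide S V W
  sameOrdering⇔sameSide {S = S} (V₁ , V₂) (W₁ , W₂) tfV tfW = mk⇔ to from
    where
    closer⇔ : ∀ U₁ U₂ → TieFree S (U₁ , U₂) → ∀ {i j} → S i < S j →
      (distSum U₁ U₂ (S i) < distSum U₁ U₂ (S j) ⇔ U₁ + U₂ < S i + S j)
    closer⇔ U₁ U₂ tf {i} {j} Si<Sj = distSum-<⇔ U₁ U₂ Si<Sj (tf i j (λ i≡j → <-irrefl (cong S i≡j) Si<Sj))
    to : SameOrdering S (V₁ , V₂) (W₁ , W₂) → SameSide S (V₁ , V₂) (W₁ , W₂)
    to same i j Si<Sj = ⇔.trans (⇔.sym (closer⇔ V₁ V₂ tfV Si<Sj)) (⇔.trans (same i j) (closer⇔ W₁ W₂ tfW Si<Sj))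
    sameFor : SameSide S (V₁ , V₂) (W₁ , W₂) → ∀ {i j} → S i < S j →
      (distSum V₁ V₂ (S i) < distSum V₁ V₂ (S j) ⇔ distSum W₁ W₂ (S i) < distSum W₁ W₂ (S j))
    sameFor side Si<Sj = ⇔.trans (closer⇔ V₁ V₂ tfV Si<Sj) (⇔.trans (side _ _ Si<Sj) (⇔.sym (closer⇔ W₁ W₂ tfW Si<Sj)))
    from : SameSide S (V₁ , V₂) (W₁ , W₂) → SameOrdering S (V₁ , V₂) (W₁ , W₂)
    from side i j with <-cmp (S i) (S j)
    ... | tri< Si<Sj _ _ = sameFor side Si<Sj
    ... | tri≈ _ Si≡Sj _ = mk⇔ (λ h → ⊥-elim (<-irrefl (cong (distSum V₁ V₂) Si≡Sj) h))
                              (λ h → ⊥-elim (<-irrefl (cong (distSum W₁ W₂) Si≡Sj) h))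
    ... | tri> _ _ Sj<Si = ⇔.trans (<⇔≯ (tfV i j i≢j))
        (⇔.trans (¬-cong-⇔ (sameFor side Sj<Si)) (⇔.sym (<⇔≯ (tfW i j i≢j))))
      where
      i≢j : i ≢ j
      i≢j i≡j = <-irrefl (cong S (sym i≡j)) Sj<Si

  sameOrdering-sym : ∀ {n} (S : Fin n → ℚ) V W → SameOrdering S V W → SameOrdering S W V
  sameOrdering-sym S (_ , _) (_ , _) same i j = ⇔.sym (same i j)

module PairSumSets where

  open import Data.Nat
  open import Data.Nat.Properties
  open import Data.Nat.Combinatorics using (_C_; nC1≡n; nCk+nC[k+1]≡[n+1]C[k+1])
  open import Data.Nat.Tactic.RingSolver using (solve-∀)
  open import Data.Empty using (⊥-elim)
  open import Data.Fin using (Fin; zero; suc; toℕ; fromℕ; fromℕ<; splitAt; join)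
  import Data.Fin.Properties as Fin
  open import Data.Product using (Σ; _×_; _,_)
  open import Data.Sum using (_⊎_; inj₁; inj₂)
  open import Function.Base using (_∘_)
  open import Function.Definitions using (Injective)
  open import Relation.Binary.PropositionalEquality
  open import Relation.Nullary using (yes; no)

  IsPairSum : ∀ {N} → (Fin N → ℕ) → ℕ → Set
  IsPairSum {N} x u = Σ (Fin N) λ i → Σ (Fin N) λ j → i ≢ j × x i + x j ≡ u

  record PairSums (N M : ℕ) : Set where
    field
      x               : Fin N → ℕ
      x-injective     : Injective _≡_ _≡_ x
      bound           : ℕ
      x<bound         : ∀ i → x i < bound
      sum             : Fin M → ℕ
      sum-injective   : Injective _≡_ _≡_ sum
      sum-isPairSum   : ∀ a → IsPairSum x (sum a)
      pairSum-listed  : ∀ {i j} → i ≢ j → Σ (Fin M) λ a → sum a ≡ x i + x j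

    pairSum<bound+bound : ∀ {u} → IsPairSum x u → u < bound + bound
    pairSum<bound+bound (i , j , _ , refl) = +-mono-< (x<bound i) (x<bound j)

  singleton : PairSums 1 0
  singleton = record
    { x              = λ _ → 0
    ; x-injective    = λ { {zero} {zero} _ → refl }
    ; bound          = 1
    ; x<bound        = λ _ → z<s
    ; sum            = λ ()
    ; sum-injective  = λ { {()} }
    ; sum-isPairSum  = λ ()
    ; pairSum-listed = λ { {zero} {zero} 0≢0 → ⊥-elim (0≢0 refl) }
    }

  splitAt-injective : ∀ m {n} → Injective _≡_ _≡_ (splitAt m {n})
  splitAt-injective m {n} {a} {b} eq = begin
    a                     ≡⟨ Fin.join-splitAt m n a ⟨
    join m n (splitAt m a) ≡⟨ cong (join m n) eq ⟩
    join m n (splitAt m b) ≡⟨ Fin.join-splitAt m n b ⟩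
    b                     ∎
    where open ≡-Reasoning

  addLargePoint : ∀ {N M} → PairSums N M → PairSums (suc N) (N + M)
  addLargePoint {N} {M} C = record
    { x              = x′
    ; x-injective    = x′-injective
    ; bound          = suc (bound + bound)
    ; x<bound        = x′<bound
    ; sum            = sum′ ∘ splitAt N
    ; sum-injective  = splitAt-injective N ∘ sum′-injective
    ; sum-isPairSum  = sum′-isPairSum ∘ splitAt N
    ; pairSum-listed = listed
    }
    where
    open PairSums C
    x′ : Fin (suc N) → ℕ
    x′ zero    = bound + bound
    x′ (suc i) = x i
    sum′ : Fin N ⊎ Fin M → ℕ
    sum′ (inj₁ i) = bound + bound + x i
    sum′ (inj₂ a) = sum a
    x<bound+bound : ∀ i → x i < bound + bound
    x<bound+bound i = <-≤-trans (x<bound i) (m≤m+n bound bound)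
    x′-injective : Injective _≡_ _≡_ x′
    x′-injective {zero}  {zero}  _  = refl
    x′-injective {zero}  {suc j} eq = ⊥-elim (<⇒≢ (x<bound+bound j) (sym eq))
    x′-injective {suc i} {zero}  eq = ⊥-elim (<⇒≢ (x<bound+bound i) eq)
    x′-injective {suc i} {suc j} eq = cong suc (x-injective eq)
    x′<bound : ∀ i → x′ i < suc (bound + bound)
    x′<bound zero    = n<1+n _
    x′<bound (suc i) = m<n⇒m<1+n (x<bound+bound i)
    new≢old : ∀ i a → bound + bound + x i ≢ sum a
    new≢old i a eq = <⇒≱ (pairSum<bound+bound (sum-isPairSum a)) (subst (bound + bound ≤_) eq (m≤m+n _ _))
    sum′-injective : Injective _≡_ _≡_ sum′
    sum′-injective {inj₁ i} {inj₁ j} eq = cong inj₁ (x-injective (+-cancelˡ-≡ (bound + bound) _ _ eq))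
    sum′-injective {inj₁ i} {inj₂ b} eq = ⊥-elim (new≢old i b eq)
    sum′-injective {inj₂ a} {inj₁ j} eq = ⊥-elim (new≢old j a (sym eq))
    sum′-injective {inj₂ a} {inj₂ b} eq = cong inj₂ (sum-injective eq)
    sum′-isPairSum : ∀ p → IsPairSum x′ (sum′ p)
    sum′-isPairSum (inj₁ i) = zero , suc i , (λ ()) , refl
    sum′-isPairSum (inj₂ a) with sum-isPairSum a
    ... | i , j , i≢j , eq = suc i , suc j , i≢j ∘ Fin.suc-injective , eq
    index : ∀ p {u} → sum′ p ≡ u → Σ (Fin (N + M)) λ a → sum′ (splitAt N a) ≡ u
    index p eq = join N M p , trans (cong sum′ (Fin.splitAt-join N M p)) eq
    listed : ∀ {i j} → i ≢ j → Σ (Fin (N + M)) λ a → sum′ (splitAt N a) ≡ x′ i + x′ j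
    listed {zero}  {zero}  0≢0 = ⊥-elim (0≢0 refl)
    listed {zero}  {suc j} _   = index (inj₁ j) refl
    listed {suc i} {zero}  _   = index (inj₁ i) (+-comm (bound + bound) (x i))
    listed {suc i} {suc j} i≢j with pairSum-listed (i≢j ∘ cong suc)
    ... | b , eq = index (inj₂ b) eq

  interval-isPairSum : ∀ {n v} → 0 < v → v < n + n → IsPairSum (toℕ {suc n}) v
  interval-isPairSum {n} {v} 0<v v<n+n with v ≤? n
  ... | yes v≤n = zero , fromℕ< (s≤s v≤n) , 0≢v , Fin.toℕ-fromℕ< (s≤s v≤n)
    where
    0≢v : zero ≢ fromℕ< (s≤s v≤n)
    0≢v eq = <⇒≢ 0<v (trans (cong toℕ eq) (Fin.toℕ-fromℕ< (s≤s v≤n)))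
  ... | no  v≰n with m≤n⇒∃[o]m+o≡n (<⇒≤ (≰⇒> v≰n))
  ...   | d , refl = fromℕ n , fromℕ< (m<n⇒m<1+n d<n) , n≢d ,
                     cong₂ _+_ (Fin.toℕ-fromℕ n) (Fin.toℕ-fromℕ< (m<n⇒m<1+n d<n))
    where
    d<n : d < n
    d<n = +-cancelˡ-< n d n v<n+n
    n≢d : fromℕ n ≢ fromℕ< (m<n⇒m<1+n d<n)
    n≢d eq = >⇒≢ d<n (trans (sym (Fin.toℕ-fromℕ n)) (trans (cong toℕ eq) (Fin.toℕ-fromℕ< _)))

  enumerate-positive : ∀ {L u} → 0 < u → u ≤ L → Σ (Fin L) λ a → suc (toℕ a) ≡ u
  enumerate-positive {u = suc u} _ u<L = fromℕ< u<L , cong suc (Fin.toℕ-fromℕ< u<L)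

  m≢n⇒0<m+n : ∀ {m n} → m ≢ n → 0 < m + n
  m≢n⇒0<m+n {zero}  {zero}  0≢0 = ⊥-elim (0≢0 refl)
  m≢n⇒0<m+n {zero}  {suc n} _   = z<s
  m≢n⇒0<m+n {suc m}         _   = z<s

  -- {0, …, n} has pairwise sums 1, …, 2n − 1 and y adds y, …, y + n;
  -- as y ≤ 2n these are exactly 1, …, y + n.
  intervalWithPoint : ∀ {n y} → n < y → y ≤ n + n → PairSums (suc (suc n)) (y + n)
  intervalWithPoint {n} {y} n<y y≤n+n = record
    { x              = x
    ; x-injective    = x-injective
    ; bound          = suc y
    ; x<bound        = x<bound
    ; sum            = suc ∘ toℕ
    ; sum-injective  = Fin.toℕ-injective ∘ suc-injective
    ; sum-isPairSum  = sum-isPairSum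
    ; pairSum-listed = λ i≢j → enumerate-positive (m≢n⇒0<m+n (i≢j ∘ x-injective)) (pairSum≤ i≢j)
    }
    where
    x : Fin (suc (suc n)) → ℕ
    x zero    = y
    x (suc i) = toℕ i
    toℕ≤n : ∀ (i : Fin (suc n)) → toℕ i ≤ n
    toℕ≤n = Fin.toℕ≤pred[n]
    toℕ<y : ∀ (i : Fin (suc n)) → toℕ i < y
    toℕ<y i = ≤-<-trans (toℕ≤n i) n<y
    x-injective : Injective _≡_ _≡_ x
    x-injective {zero}  {zero}  _  = refl
    x-injective {zero}  {suc j} eq = ⊥-elim (>⇒≢ (toℕ<y j) eq)
    x-injective {suc i} {zero}  eq = ⊥-elim (<⇒≢ (toℕ<y i) eq)
    x-injective {suc i} {suc j} eq = cong suc (Fin.toℕ-injective eq)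
    x<bound : ∀ i → x i < suc y
    x<bound zero    = n<1+n y
    x<bound (suc i) = m<n⇒m<1+n (toℕ<y i)
    sum-isPairSum : ∀ a → IsPairSum x (suc (toℕ a))
    sum-isPairSum a with y ≤? suc (toℕ a)
    ... | yes y≤v with m≤n⇒∃[o]m+o≡n y≤v
    ...   | d , eq = zero , suc (fromℕ< (s≤s d≤n)) , (λ ()) , trans (cong (y +_) (Fin.toℕ-fromℕ< (s≤s d≤n))) eq
      where
      d≤n : d ≤ n
      d≤n = +-cancelˡ-≤ y d n (subst (_≤ y + n) (sym eq) (Fin.toℕ<n a))
    sum-isPairSum a | no y≰v with interval-isPairSum z<s (<-≤-trans (≰⇒> y≰v) y≤n+n)
    ... | i , j , i≢j , eq = suc i , suc j , i≢j ∘ Fin.suc-injective , eq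
    pairSum≤ : ∀ {i j} → i ≢ j → x i + x j ≤ y + n
    pairSum≤ {zero}  {zero}  0≢0 = ⊥-elim (0≢0 refl)
    pairSum≤ {zero}  {suc j} _   = +-monoʳ-≤ y (toℕ≤n j)
    pairSum≤ {suc i} {zero}  _   = subst (_≤ y + n) (+-comm y (toℕ i)) (+-monoʳ-≤ y (toℕ≤n i))
    pairSum≤ {suc i} {suc j} _   = +-mono-≤ (<⇒≤ (toℕ<y i)) (toℕ≤n j)

  [1+n]C2≡n+nC2 : ∀ n → suc n C 2 ≡ n + n C 2
  [1+n]C2≡n+nC2 n = trans (sym (nCk+nC[k+1]≡[n+1]C[k+1] n 1)) (cong (_+ n C 2) (nC1≡n n))

  pairSums-exist : ∀ n M → n + n ≤ suc M → M ≤ suc n C 2 → PairSums (suc n) M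
  pairSums-exist zero    M _ M≤0 rewrite n≤0⇒n≡0 M≤0 = singleton
  pairSums-exist (suc m) M (s≤s lo) hi with M ≤? m + (m + m)
  ... | yes M≤3m with m≤n⇒∃[o]m+o≡n (≤-trans (m≤m+n m (suc m)) lo)
  ...   | y , refl = subst (PairSums (2 + m)) (+-comm y m)
                       (intervalWithPoint (+-cancelˡ-≤ m (suc m) y lo) (+-cancelˡ-≤ m y (m + m) M≤3m))
  pairSums-exist (suc m) M (s≤s lo) hi | no M≰3m with m≤n⇒∃[o]m+o≡n (≤-trans (s≤s (m≤m+n m (m + m))) (≰⇒> M≰3m))
  ... | M′ , refl = addLargePoint (pairSums-exist m M′ lo′ hi′)
    where
    lo′ : m + m ≤ suc M′
    lo′ = m≤n⇒m≤1+n (+-cancelˡ-≤ m (m + m) M′ (s≤s⁻¹ (≰⇒> M≰3m)))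
    hi′ : M′ ≤ suc m C 2
    hi′ = +-cancelˡ-≤ (suc m) M′ (suc m C 2) (subst (suc m + M′ ≤_) ([1+n]C2≡n+nC2 (suc m)) hi)

  2*nC2+n≡n*n : ∀ n → 2 * (n C 2) + n ≡ n * n
  2*nC2+n≡n*n zero    = refl
  2*nC2+n≡n*n (suc n) = begin
    2 * (suc n C 2) + suc n        ≡⟨ cong (λ c → 2 * c + suc n) ([1+n]C2≡n+nC2 n) ⟩
    2 * (n + n C 2) + suc n        ≡⟨ regroup n (n C 2) ⟩
    suc n + n + (2 * (n C 2) + n)  ≡⟨ cong (suc n + n +_) (2*nC2+n≡n*n n) ⟩
    suc n + n + n * n              ≡⟨ square n ⟩
    suc n * suc n                  ∎
    where
    open ≡-Reasoning
    regroup : ∀ n c → 2 * (n + c) + suc n ≡ suc n + n + (2 * c + n)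
    regroup = solve-∀
    square : ∀ n → suc n + n + n * n ≡ suc n * suc n
    square = solve-∀

  n*n∸n≡2*nC2 : ∀ n → n * n ∸ n ≡ 2 * (n C 2)
  n*n∸n≡2*nC2 n = trans (cong (_∸ n) (sym (2*nC2+n≡n*n n))) (m+n∸n≡m (2 * (n C 2)) n)

  2[1+n]∸2≡n+n : ∀ n → 2 * suc n ∸ 2 ≡ n + n
  2[1+n]∸2≡n+n n = trans (sym (*-distribˡ-∸ 2 (suc n) 1)) (cong (n +_) (+-identityʳ n))

  2[1+M]≤n*n∸n+2⇒M≤nC2 : ∀ n M → 2 * suc M ≤ n * n ∸ n + 2 → M ≤ n C 2
  2[1+M]≤n*n∸n+2⇒M≤nC2 n M h = *-cancelˡ-≤ 2 (+-cancelˡ-≤ 2 (2 * M) (2 * (n C 2)) (begin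
    2 + 2 * M          ≡⟨ *-suc 2 M ⟨
    2 * suc M          ≤⟨ h ⟩
    n * n ∸ n + 2      ≡⟨ cong (_+ 2) (n*n∸n≡2*nC2 n) ⟩
    2 * (n C 2) + 2    ≡⟨ +-comm (2 * (n C 2)) 2 ⟩
    2 + 2 * (n C 2)    ∎))
    where open ≤-Reasoning

module Orderings where

  open import Data.Rational
  open import Data.Rational.Properties
  open import Data.Nat as ℕ using (ℕ; zero; suc)
  import Data.Nat.Properties as ℕ
  open import Data.Nat.Tactic.RingSolver using (solve-∀)
  open import Data.Empty using (⊥-elim)
  open import Data.Fin using (Fin; zero; suc)
  open import Data.Product using (Σ; _×_; _,_)
  open import Data.Sum using (_⊎_; inj₁; inj₂)
  open import Function.Base using (_∘′_)
  open import Function.Bundles using (_⇔_; mk⇔; Equivalence)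
  import Function.Properties.Equivalence as ⇔
  open import Level using (0ℓ)
  open import Relation.Binary.Definitions using (tri<; tri≈; tri>)
  open import Relation.Binary.PropositionalEquality
  open import Relation.Nullary using (¬_; yes; no)
  open import Relation.Unary using (Pred; Decidable)
  open Vantage
  open PairSumSets

  argmin-satisfying : ∀ {m} {P : Pred ℕ 0ℓ} → Decidable P → (f : Fin m → ℕ) →
    (∀ a → ¬ P (f a)) ⊎ Σ (Fin m) λ a → P (f a) × (∀ b → P (f b) → f a ℕ.≤ f b)
  argmin-satisfying {zero}  P? f = inj₁ λ ()
  argmin-satisfying {suc m} P? f with P? (f zero) | argmin-satisfying P? (f ∘′ suc)
  ... | no ¬P₀ | inj₁ none = inj₁ λ { zero → ¬P₀ ; (suc b) → none b }
  ... | no ¬P₀ | inj₂ (a , Pa , min) = inj₂ (suc a , Pa , λ { zero P₀ → ⊥-elim (¬P₀ P₀) ; (suc b) → min b })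
  ... | yes P₀ | inj₁ none = inj₂ (zero , P₀ , λ { zero _ → ℕ.≤-refl ; (suc b) Pb → ⊥-elim (none b Pb) })
  ... | yes P₀ | inj₂ (a , Pa , min) with f zero ℕ.≤? f (suc a)
  ...   | yes f₀≤ = inj₂ (zero , P₀ , λ { zero _ → ℕ.≤-refl ; (suc b) Pb → ℕ.≤-trans f₀≤ (min b Pb) })
  ...   | no  f₀≰ = inj₂ (suc a , Pa , λ { zero _ → ℕ.<⇒≤ (ℕ.≰⇒> f₀≰) ; (suc b) Pb → min b Pb })

  fromℕ : ℕ → ℚ
  fromℕ zero    = 0ℚ
  fromℕ (suc n) = 1ℚ + fromℕ n

  fromℕ-+ : ∀ m n → fromℕ (m ℕ.+ n) ≡ fromℕ m + fromℕ n
  fromℕ-+ zero    n = sym (+-identityˡ (fromℕ n))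
  fromℕ-+ (suc m) n = trans (cong (1ℚ +_) (fromℕ-+ m n)) (sym (+-assoc 1ℚ (fromℕ m) (fromℕ n)))

  fromℕ-<-suc : ∀ n → fromℕ n < fromℕ (suc n)
  fromℕ-<-suc n = gap⇒< (positive⁻¹ 1ℚ) (+-comm (fromℕ n) 1ℚ)

  fromℕ-mono-≤ : ∀ {m n} → m ℕ.≤ n → fromℕ m ≤ fromℕ n
  fromℕ-mono-≤ {n = zero}  ℕ.z≤n     = ≤-refl
  fromℕ-mono-≤ {n = suc n} ℕ.z≤n     = ≤-trans (fromℕ-mono-≤ {n = n} ℕ.z≤n) (<⇒≤ (fromℕ-<-suc n))
  fromℕ-mono-≤             (ℕ.s≤s h) = +-monoʳ-≤ 1ℚ (fromℕ-mono-≤ h)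

  fromℕ-mono-< : ∀ {m n} → m ℕ.< n → fromℕ m < fromℕ n
  fromℕ-mono-< {m} m<n = <-≤-trans (fromℕ-<-suc m) (fromℕ-mono-≤ m<n)

  fromℕ-injective : ∀ {m n} → fromℕ m ≡ fromℕ n → m ≡ n
  fromℕ-injective {m} {n} eq with ℕ.<-cmp m n
  ... | tri< m<n _ _ = ⊥-elim (<⇒≢ (fromℕ-mono-< m<n) eq)
  ... | tri≈ _ m≡n _ = m≡n
  ... | tri> _ _ n<m = ⊥-elim (<⇒≢ (fromℕ-mono-< n<m) (sym eq))

  -- Scaling by 4 puts every pairwise sum at 4u + 2 and the vantage sum of (2w, 2w), namely 4w,
  -- strictly between the consecutive candidates 4(w − 1) + 2 and 4w + 2.
  point : ℕ → ℚ
  point u = fromℕ (4 ℕ.* u ℕ.+ 1)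

  pairPoint : ℕ → ℚ
  pairPoint u = fromℕ (4 ℕ.* u ℕ.+ 2)

  vantage : ℕ → ℚ × ℚ
  vantage w = fromℕ (2 ℕ.* w) , fromℕ (2 ℕ.* w)

  point-+ : ∀ a b → point a + point b ≡ pairPoint (a ℕ.+ b)
  point-+ a b = trans (sym (fromℕ-+ (4 ℕ.* a ℕ.+ 1) (4 ℕ.* b ℕ.+ 1))) (cong fromℕ (regroup a b))
    where
    regroup : ∀ a b → (4 ℕ.* a ℕ.+ 1) ℕ.+ (4 ℕ.* b ℕ.+ 1) ≡ 4 ℕ.* (a ℕ.+ b) ℕ.+ 2
    regroup = solve-∀

  pairPoint-mono-≤ : ∀ {u v} → u ℕ.≤ v → pairPoint u ≤ pairPoint v
  pairPoint-mono-≤ u≤v = fromℕ-mono-≤ (ℕ.+-monoˡ-≤ 2 (ℕ.*-monoʳ-≤ 4 u≤v))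

  4w<4u+2 : ∀ {w u} → w ℕ.≤ u → 4 ℕ.* w ℕ.< 4 ℕ.* u ℕ.+ 2
  4w<4u+2 {w} {u} w≤u = ℕ.≤-<-trans (ℕ.*-monoʳ-≤ 4 w≤u) (ℕ.m<m+n (4 ℕ.* u) ℕ.z<s)

  4u+2<4w : ∀ {w u} → u ℕ.< w → 4 ℕ.* u ℕ.+ 2 ℕ.< 4 ℕ.* w
  4u+2<4w {w} {u} u<w = begin-strict
    4 ℕ.* u ℕ.+ 2 <⟨ ℕ.+-monoʳ-< (4 ℕ.* u) (ℕ.s≤s (ℕ.s≤s (ℕ.s≤s ℕ.z≤n))) ⟩
    4 ℕ.* u ℕ.+ 4 ≡⟨ ℕ.+-comm (4 ℕ.* u) 4 ⟩
    4 ℕ.+ 4 ℕ.* u ≡⟨ ℕ.*-suc 4 u ⟨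
    4 ℕ.* suc u   ≤⟨ ℕ.*-monoʳ-≤ 4 u<w ⟩
    4 ℕ.* w       ∎
    where open ℕ.≤-Reasoning

  vantage-sum : ∀ w → fromℕ (2 ℕ.* w) + fromℕ (2 ℕ.* w) ≡ fromℕ (4 ℕ.* w)
  vantage-sum w = trans (sym (fromℕ-+ (2 ℕ.* w) (2 ℕ.* w))) (cong fromℕ (double w))
    where
    double : ∀ w → 2 ℕ.* w ℕ.+ 2 ℕ.* w ≡ 4 ℕ.* w
    double = solve-∀

  vantage<pairPoint⇔ : ∀ w u → (fromℕ (2 ℕ.* w) + fromℕ (2 ℕ.* w) < pairPoint u ⇔ w ℕ.≤ u)
  vantage<pairPoint⇔ w u rewrite vantage-sum w = mk⇔ to (fromℕ-mono-< ∘′ 4w<4u+2)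
    where
    to : fromℕ (4 ℕ.* w) < pairPoint u → w ℕ.≤ u
    to h with w ℕ.≤? u
    ... | yes w≤u = w≤u
    ... | no  w≰u = ⊥-elim (<-asym h (fromℕ-mono-< (4u+2<4w (ℕ.≰⇒> w≰u))))

  vantage≢pairPoint : ∀ w u → fromℕ (2 ℕ.* w) + fromℕ (2 ℕ.* w) ≢ pairPoint u
  vantage≢pairPoint w u with w ℕ.≤? u
  ... | yes w≤u = <⇒≢ (Equivalence.from (vantage<pairPoint⇔ w u) w≤u)
  ... | no  w≰u = ≢-sym (<⇒≢ (subst (pairPoint u <_) (sym (vantage-sum w)) (fromℕ-mono-< (4u+2<4w (ℕ.≰⇒> w≰u)))))

  module _ {N M} (C : PairSums N M) where
    open PairSums C

    S : Fin N → ℚ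
    S = point ∘′ x

    S-distinct : Distinct S
    S-distinct i j eq = x-injective (ℕ.*-cancelˡ-≡ _ _ 4 (ℕ.+-cancelʳ-≡ 1 _ _ (fromℕ-injective eq)))

    S-+ : ∀ i j → S i + S j ≡ pairPoint (x i ℕ.+ x j)
    S-+ i j = point-+ (x i) (x j)

    vantage-tieFree : ∀ w → TieFree S (vantage w)
    vantage-tieFree w i j i≢j = distSum-diagonal-≢ (fromℕ (2 ℕ.* w))
      (i≢j ∘′ S-distinct i j) (subst (_ ≢_) (sym (S-+ i j)) (vantage≢pairPoint w (x i ℕ.+ x j)))

    vantage<S+S⇔ : ∀ w i j → (fromℕ (2 ℕ.* w) + fromℕ (2 ℕ.* w) < S i + S j ⇔ w ℕ.≤ x i ℕ.+ x j)
    vantage<S+S⇔ w i j rewrite S-+ i j = vantage<pairPoint⇔ w (x i ℕ.+ x j)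

    ordered-pairSum : ∀ {u} → IsPairSum x u → Σ (Fin N) λ i → Σ (Fin N) λ j → S i < S j × x i ℕ.+ x j ≡ u
    ordered-pairSum (i , j , i≢j , eq) with <-cmp (S i) (S j)
    ... | tri< Si<Sj _ _ = i , j , Si<Sj , eq
    ... | tri≈ _ Si≡Sj _ = ⊥-elim (i≢j (S-distinct i j Si≡Sj))
    ... | tri> _ _ Sj<Si = j , i , Sj<Si , trans (ℕ.+-comm (x j) (x i)) eq

    vantage-separated : ∀ {w₁ w₂} → w₁ ℕ.< w₂ → IsPairSum x w₁ → ¬ SameOrdering S (vantage w₁) (vantage w₂)
    vantage-separated {w₁} {w₂} w₁<w₂ isSum same with ordered-pairSum isSum
    ... | i , j , Si<Sj , refl = ℕ.<⇒≱ w₁<w₂ (Equivalence.to sameCut ℕ.≤-refl)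
      where
      side : (fromℕ (2 ℕ.* w₁) + fromℕ (2 ℕ.* w₁) < S i + S j ⇔ fromℕ (2 ℕ.* w₂) + fromℕ (2 ℕ.* w₂) < S i + S j)
      side = Equivalence.to (sameOrdering⇔sameSide (vantage w₁) (vantage w₂)
        (vantage-tieFree w₁) (vantage-tieFree w₂)) same i j Si<Sj
      sameCut : w₁ ℕ.≤ w₁ ⇔ w₂ ℕ.≤ w₁
      sameCut = ⇔.trans (⇔.sym (vantage<S+S⇔ w₁ i j)) (⇔.trans side (vantage<S+S⇔ w₂ i j))

    sameOrdering-vantage : ∀ V₁ V₂ w → TieFree S (V₁ , V₂) →
      (∀ {i j} → i ≢ j → (V₁ + V₂ < pairPoint (x i ℕ.+ x j) ⇔ w ℕ.≤ x i ℕ.+ x j)) →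
      SameOrdering S (V₁ , V₂) (vantage w)
    sameOrdering-vantage V₁ V₂ w tfV cuts =
      Equivalence.from (sameOrdering⇔sameSide (V₁ , V₂) (vantage w) tfV (vantage-tieFree w)) side
      where
      side : SameSide S (V₁ , V₂) (vantage w)
      side i j Si<Sj = ⇔.trans (subst (λ t → (V₁ + V₂ < t ⇔ w ℕ.≤ x i ℕ.+ x j)) (sym (S-+ i j)) (cuts i≢j))
                               (⇔.sym (vantage<S+S⇔ w i j))
        where
        i≢j : i ≢ j
        i≢j i≡j = <-irrefl (cong S i≡j) Si<Sj

    -- vantage (cut (suc a)) sits just below the pairwise sum sum a; vantage (cut zero) above all of them.
    cut : Fin (suc M) → ℕ
    cut zero    = bound ℕ.+ bound
    cut (suc a) = sum a

    sum<top : ∀ a → sum a ℕ.< bound ℕ.+ bound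
    sum<top a = pairSum<bound+bound (sum-isPairSum a)

    cut-distinct : ∀ a b → SameOrdering S (vantage (cut a)) (vantage (cut b)) → a ≡ b
    cut-distinct zero    zero    _    = refl
    cut-distinct zero    (suc b) same = ⊥-elim (vantage-separated (sum<top b) (sum-isPairSum b)
      (sameOrdering-sym S (vantage (cut zero)) (vantage (cut (suc b))) same))
    cut-distinct (suc a) zero    same = ⊥-elim (vantage-separated (sum<top a) (sum-isPairSum a) same)
    cut-distinct (suc a) (suc b) same with ℕ.<-cmp (sum a) (sum b)
    ... | tri< a<b _ _ = ⊥-elim (vantage-separated a<b (sum-isPairSum a) same)
    ... | tri≈ _ a≡b _ = cong suc (sum-injective a≡b)
    ... | tri> _ _ b<a = ⊥-elim (vantage-separated b<a (sum-isPairSum b)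
      (sameOrdering-sym S (vantage (sum a)) (vantage (sum b)) same))

    cut-complete : ∀ V → TieFree S V → Σ (Fin (suc M)) λ a → SameOrdering S V (vantage (cut a))
    cut-complete (V₁ , V₂) tfV with argmin-satisfying (λ u → V₁ + V₂ <? pairPoint u) sum
    ... | inj₁ none = zero , sameOrdering-vantage V₁ V₂ (cut zero) tfV above-all
      where
      above-all : ∀ {i j} → i ≢ j → (V₁ + V₂ < pairPoint (x i ℕ.+ x j) ⇔ bound ℕ.+ bound ℕ.≤ x i ℕ.+ x j)
      above-all {i} {j} i≢j with pairSum-listed i≢j
      ... | a , eq rewrite sym eq = mk⇔ (⊥-elim ∘′ none a) (⊥-elim ∘′ ℕ.<⇒≱ (sum<top a))
    ... | inj₂ (a , below-a , minimal) = suc a , sameOrdering-vantage V₁ V₂ (cut (suc a)) tfV just-below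
      where
      just-below : ∀ {i j} → i ≢ j → (V₁ + V₂ < pairPoint (x i ℕ.+ x j) ⇔ sum a ℕ.≤ x i ℕ.+ x j)
      just-below {i} {j} i≢j with pairSum-listed i≢j
      ... | b , eq rewrite sym eq = mk⇔ (minimal b) (<-≤-trans below-a ∘′ pairPoint-mono-≤)

  orderings-of-pairSums : ∀ {N M} → PairSums N M → Σ (Fin N → ℚ) λ S → Distinct S × NumOrderings S (suc M)
  orderings-of-pairSums C =
    S C , S-distinct C , vantage ∘′ cut C , (λ a → vantage-tieFree C (cut C a)) , cut-distinct C , cut-complete C

open import Data.Nat using (ℕ; _≤_; _*_; _+_; _∸_; zero; suc; s≤s)
open import Data.Fin using (Fin)
open import Data.Rational using (ℚ)
open import Data.Product using (Σ; _×_)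
open import Relation.Binary.PropositionalEquality using (subst)
open PairSumSets using (pairSums-exist; 2[1+n]∸2≡n+n; 2[1+M]≤n*n∸n+2⇒M≤nC2)
open Orderings using (orderings-of-pairSums)

corollary5p6 : (n k : ℕ) → 2 ≤ n → 2 * n ∸ 2 ≤ k → 2 * k ≤ n * n ∸ n + 2 →
    Σ (Fin n → ℚ) λ S → Distinct S × NumOrderings S k
corollary5p6 zero          _       ()
corollary5p6 (suc zero)    _       (s≤s ())
corollary5p6 (suc (suc n)) zero    _ lo _ with subst (_≤ 0) (2[1+n]∸2≡n+n (suc n)) lo
... | ()
corollary5p6 (suc n)       (suc M) _ lo hi = orderings-of-pairSums (pairSums-exist n M
  (subst (_≤ suc M) (2[1+n]∸2≡n+n n) lo)
  (2[1+M]≤n*n∸n+2⇒M≤nC2 (suc n) M hi))
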